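{- Let $D$ be a finite simple digraph and let $x,y,z$ be vertices such that $xyz$ is a path of length $2$ in the underlying graph $G[D]$ with $yx, yz \in A(D)$. Then \[b_I(D) \leq \deg_{G[D]}(x) + \deg_D^-(y) + \deg_{G[D]}(z) - |N^-(x)\cap N^-(y)\cap N^-(z)|.\] Moreover, if $x$ and $z$ are adjacent in $G[D]$, then \[b_I(D) \leq \deg_{G[D]}(x) + \deg_D^-(y) + \deg_{G[D]}(z) - 1 - |N^-(x)\cap N^-(y)\cap N^-(z)|.\]
   Context: A finite simple digraph has no loops and no multiple arcs (oppositely oriented arcs allowed). $N^-(v)=N_D^-(v)$ denotes the set of in-neighbors of $v$ in $D$ and $\deg_D^-(v)=|N_D^-(v)|$. The underlying graph $G[D]$ is the multigraph obtained by replacing each arc $uv$ by an edge $uv$ (so $G[D]$ has two parallel edges $uv$ when both $uv,vu\in A(D)$); $\deg_{G[D]}(v)$ is the degree of $v$ in $G[D]$. An Italian dominating function (IDF) on $D$ is a function $f:V(D)\to\{0,1,2\}$ such that every vertex $v$ with $f(v)=0$ has at least two in-neighbors $w$ with $f(w)=1$ or at least one in-neighbor $w$ with $f(w)=2$; its weight is $\sum_{u}f(u)$ and $\gamma_I(D)$ is the minimum weight of an IDF. The Italian bondage number $b_I(D)$ is the minimum number of arcs of $A(D)$ whose removal from $D$ (keeping all vertices) results in a digraph $D'$ with $\gamma_I(D')>\gamma_I(D)$. -}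

module Defs where

open import Data.Nat using (ℕ; zero; suc; _+_; _≤_; _<_; _≡ᵇ_)
open import Data.Fin using (Fin; zero; suc)
open import Data.Bool using (Bool; true; false; _∧_; _∨_; not; if_then_else_)
open import Data.Product using (Σ; ∃; _×_; _,_)
open import Data.Sum using (_⊎_)
open import Relation.Binary.PropositionalEquality using (_≡_)

sumF : ∀ {n} → (Fin n → ℕ) → ℕ
sumF {zero}  f = 0
sumF {suc n} f = f zero + sumF (λ i → f (suc i))

count : ∀ {n} → (Fin n → Bool) → ℕ
count p = sumF (λ i → if p i then 1 else 0)

-- finite simple digraph on vertex set Fin n: arc u v = true iff uv ∈ A(D).
-- Boolean adjacency rules out multiple arcs; loops are excluded explicitly.
record Digraph (n : ℕ) : Set where
  field
    arc      : Fin n → Fin n → Bool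
    loopless : ∀ v → arc v v ≡ false
open Digraph public

indeg : ∀ {n} → Digraph n → Fin n → ℕ
indeg D v = count (λ u → arc D u v)

outdeg : ∀ {n} → Digraph n → Fin n → ℕ
outdeg D v = count (λ u → arc D v u)

-- degree in the underlying multigraph G[D] (each arc gives one edge)
degG : ∀ {n} → Digraph n → Fin n → ℕ
degG D v = indeg D v + outdeg D v

adjG : ∀ {n} → Digraph n → Fin n → Fin n → Bool
adjG D u v = arc D u v ∨ arc D v u

commonIn : ∀ {n} → Digraph n → Fin n → Fin n → Fin n → ℕ
commonIn D x y z = count (λ u → arc D u x ∧ (arc D u y ∧ arc D u z))

IsIDF : ∀ {n} → Digraph n → (Fin n → ℕ) → Set
IsIDF D f =
  (∀ v → f v ≤ 2) ×
  (∀ v → f v ≡ 0 →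
     (2 ≤ count (λ w → arc D w v ∧ (f w ≡ᵇ 1)))
     ⊎ (∃ λ w → (arc D w v ≡ true) × (f w ≡ 2)))

weight : ∀ {n} → (Fin n → ℕ) → ℕ
weight f = sumF f

IsGammaI : ∀ {n} → Digraph n → ℕ → Set
IsGammaI D g =
  (∃ λ f → IsIDF D f × (weight f ≡ g)) ×
  (∀ f → IsIDF D f → g ≤ weight f)

ArcSet : ℕ → Set
ArcSet n = Fin n → Fin n → Bool

_⊆A_ : ∀ {n} → ArcSet n → Digraph n → Set
S ⊆A D = ∀ u v → S u v ≡ true → arc D u v ≡ true

size : ∀ {n} → ArcSet n → ℕ
size S = sumF (λ u → count (S u))

removeArcs : ∀ {n} → (D : Digraph n) → ArcSet n → Digraph n
removeArcs D S = record
  { arc = λ u v → arc D u v ∧ not (S u v)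
  ; loopless = λ v → lemma (arc D v v) (loopless D v) (not (S v v)) }
  where
  lemma : ∀ a → a ≡ false → ∀ b → (a ∧ b) ≡ false
  lemma false _ b = Relation.Binary.PropositionalEquality.refl

Increases : ∀ {n} → Digraph n → ArcSet n → Set
Increases D S = ∀ g g' → IsGammaI D g → IsGammaI (removeArcs D S) g' → g < g'

IsItalianBondage : ∀ {n} → Digraph n → ℕ → Set
IsItalianBondage D b =
  (∃ λ S → (S ⊆A D) × Increases D S × (size S ≡ b)) ×
  (∀ S → S ⊆A D → Increases D S → b ≤ size S)

-- Delete from D every arc incident with x or z, and every arc into y whose tail is not an
-- in-neighbour of both x and z. Arcs into y from common in-neighbours of x, y, z survive, and an
-- arc between x and z is counted in both deg x and deg z, which accounts for the two bounds.
-- In the resulting D′ the vertices x and z are isolated, so every IDF f′ of D′ has f′ x, f′ z ≥ 1.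
-- Moving that weight onto y, i.e. f x = f z = 0, f y = 2 if f′ y > 0 and f y = 0 otherwise, gives
-- an IDF of D that is strictly lighter: if f y = 2 then y dominates x, z and its out-neighbours;
-- if f′ y = 0 then y was dominated in D′ from common in-neighbours of x and z, which dominate x
-- and z in D as well. So γ_I(D′) > γ_I(D). The minima γ_I and b_I exist constructively because
-- labellings in {0,1,2} and arc sets range over finite, exhaustively searchable spaces.

module Submission where

open import Defs
open import Data.Nat using (ℕ; _+_; _∸_; _≤_)
open import Data.Fin using (Fin)
open import Data.Bool using (true)
open import Data.Product using (∃; _×_)
open import Relation.Binary.PropositionalEquality using (_≡_; _≢_)

open import Data.Bool as Bool using (Bool; false; _∧_; _∨_; not; if_then_else_)
open import Data.Bool.Properties using (not-injective; ∧-commutativeMonoid; ∧-conicalˡ; ∧-conicalʳ; ∨-conicalʳ; ∨-zeroʳ; ∧-assoc; if-∧)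
open import Data.Fin using (zero; suc; toℕ; fromℕ; fromℕ<)
open import Data.Fin.Properties using (_≟_; any?; all?; ¬∀⟶∃¬-smallest; toℕ-fromℕ; toℕ-fromℕ<; toℕ-inject)
open import Data.Nat as ℕ using (suc; _<_; _≡ᵇ_; z≤n; s≤s)
open import Data.Nat.Properties hiding (_≟_)
open import Algebra.Bundles using (CommutativeMonoid)
open import Algebra.Properties.CommutativeSemigroup +-commutativeSemigroup using (interchange; xy∙z≈xz∙y; xy∙z≈zy∙x)
open import Algebra.Properties.CommutativeSemigroup (CommutativeMonoid.commutativeSemigroup ∧-commutativeMonoid) using () renaming (x∙yz≈y∙xz to ∧-left-comm)
open import Data.Product using (_,_; proj₁; proj₂)
open import Data.Sum using (_⊎_; inj₁; inj₂)
open import Data.Vec.Functional using (Vector; _∷_; head; tail; updateAt)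
open import Data.Vec.Functional.Properties using (updateAt-updates; updateAt-minimal)
open import Data.Vec.Functional.Relation.Binary.Pointwise using (Pointwise)
open import Function using (_∘_; const)
open import Level using (0ℓ)
open import Relation.Binary.Core using (Rel)
open import Relation.Binary.Definitions using (Reflexive; _Respects_)
open import Relation.Binary.PropositionalEquality using (refl; sym; trans; cong; cong₂; subst; subst₂; ≢-sym; module ≡-Reasoning)
open import Relation.Nullary using (Dec; yes; no; does; ¬_; ¬?; contradiction)
open import Relation.Nullary.Decidable using (map′; dec-true; decidable-stable; _×-dec_; _⊎-dec_; _→-dec_)
open import Relation.Unary using (Pred; Decidable)

-- Least witnesses and exhaustive search

least-witness : ∀ {P : Pred ℕ 0ℓ} → Decidable P → ∀ {k} → P k →
                ∃ λ m → P m × (∀ {j} → P j → m ≤ j)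
least-witness {P} P? {k} Pk
  with i , ¬¬Pi , below ← ¬∀⟶∃¬-smallest (suc k) (λ i → ¬ P (toℕ i)) (λ i → ¬? (P? (toℕ i)))
                             (λ ¬P → ¬P (fromℕ k) (subst P (sym (toℕ-fromℕ k)) Pk))
  = toℕ i , decidable-stable (P? (toℕ i)) ¬¬Pi ,
    λ Pj → ≮⇒≥ λ j<i → below (fromℕ< j<i)
                             (subst P (sym (trans (toℕ-inject _) (toℕ-fromℕ< j<i))) Pj)

Exhaustible : (A : Set) → Rel A 0ℓ → Set₁
Exhaustible A _≈_ = ∀ {P : Pred A 0ℓ} → P Respects _≈_ → Decidable P → Dec (∃ P)

exhaustible-Bool : Exhaustible Bool _≡_
exhaustible-Bool _ P? = map′ (λ { (inj₁ p) → true , p ; (inj₂ p) → false , p })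
                             (λ { (true , p) → inj₁ p ; (false , p) → inj₂ p })
                             (P? true ⊎-dec P? false)

exhaustible-Fin : ∀ {k} → Exhaustible (Fin k) _≡_
exhaustible-Fin _ = any?

exhaustible-Vector : ∀ {A : Set} {_≈_ : Rel A 0ℓ} → Reflexive _≈_ → Exhaustible A _≈_ →
                     ∀ m → Exhaustible (Vector A m) (Pointwise _≈_)
exhaustible-Vector {A} _ _ ℕ.zero resp P? =
  map′ (empty ,_) (λ (_ , p) → resp {y = empty} (λ ()) p) (P? empty)
  where
  empty : Vector A 0
  empty ()
exhaustible-Vector {_≈_ = _≈_} refl≈ exA (suc m) {P} resp P? =
  map′ (λ (a , t , p) → a ∷ t , p)
       (λ (f , p) → head f , tail f , resp η p)
       (exA resp-head (λ a → exhaustible-Vector refl≈ exA m (resp-tail a) (P? ∘ (a ∷_))))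
  where
  η : ∀ {f} → Pointwise _≈_ f (head f ∷ tail f)
  η zero    = refl≈
  η (suc i) = refl≈
  resp-tail : ∀ a → (P ∘ (a ∷_)) Respects Pointwise _≈_
  resp-tail a t≈u = resp λ { zero → refl≈ ; (suc i) → t≈u i }
  resp-head : (λ a → ∃ λ t → P (a ∷ t)) Respects _≈_
  resp-head a≈b (t , p) = t , resp (λ { zero → a≈b ; (suc i) → refl≈ }) p

-- Finite sums and counting

⟦_⟧ : Bool → ℕ
⟦ b ⟧ = if b then 1 else 0

sumF-cong : ∀ {n} {f g : Fin n → ℕ} → (∀ i → f i ≡ g i) → sumF f ≡ sumF g
sumF-cong {ℕ.zero} _   = refl
sumF-cong {suc n}  f≗g = cong₂ _+_ (f≗g zero) (sumF-cong (f≗g ∘ suc))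

sumF-mono : ∀ {n} {f g : Fin n → ℕ} → (∀ i → f i ≤ g i) → sumF f ≤ sumF g
sumF-mono {ℕ.zero} _   = z≤n
sumF-mono {suc n}  f≤g = +-mono-≤ (f≤g zero) (sumF-mono (f≤g ∘ suc))

sumF-+ : ∀ {n} (f g : Fin n → ℕ) → sumF (λ i → f i + g i) ≡ sumF f + sumF g
sumF-+ {ℕ.zero} f g = refl
sumF-+ {suc n}  f g =
  trans (cong (f zero + g zero +_) (sumF-+ (f ∘ suc) (g ∘ suc)))
        (interchange (f zero) (g zero) (sumF (f ∘ suc)) (sumF (g ∘ suc)))

sumF-+-pointwise : ∀ {n} {f g h k : Fin n → ℕ} → (∀ i → f i + g i ≡ h i + k i) →
                   sumF f + sumF g ≡ sumF h + sumF k
sumF-+-pointwise {f = f} {g} {h} {k} eq =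
  trans (sym (sumF-+ f g)) (trans (sumF-cong eq) (sumF-+ h k))

sumF-zero : ∀ n → sumF {n} (λ _ → 0) ≡ 0
sumF-zero ℕ.zero  = refl
sumF-zero (suc n) = sumF-zero n

≤-sumF : ∀ {n} (f : Fin n → ℕ) i → f i ≤ sumF f
≤-sumF f zero    = m≤m+n (f zero) _
≤-sumF f (suc i) = ≤-trans (≤-sumF (f ∘ suc) i) (m≤n+m _ (f zero))

sumF-at : ∀ {n} (t : Fin n) (f : Fin n → ℕ) → sumF (λ i → if does (i ≟ t) then f i else 0) ≡ f t
sumF-at {suc n} zero    f = trans (cong (f zero +_) (sumF-zero n)) (+-identityʳ (f zero))
sumF-at {suc n} (suc t) f = sumF-at t (f ∘ suc)

sumF-updateAt : ∀ {n} (f : Fin n → ℕ) t h → sumF (updateAt f t h) + f t ≡ sumF f + h (f t)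
sumF-updateAt f zero    h = xy∙z≈zy∙x (h (f zero)) (sumF (f ∘ suc)) (f zero)
sumF-updateAt f (suc t) h = begin
  f zero + sumF (updateAt (f ∘ suc) t h) + f (suc t)
    ≡⟨ +-assoc (f zero) _ (f (suc t)) ⟩
  f zero + (sumF (updateAt (f ∘ suc) t h) + f (suc t))
    ≡⟨ cong (f zero +_) (sumF-updateAt (f ∘ suc) t h) ⟩
  f zero + (sumF (f ∘ suc) + h (f (suc t)))
    ≡⟨ +-assoc (f zero) (sumF (f ∘ suc)) _ ⟨
  f zero + sumF (f ∘ suc) + h (f (suc t)) ∎
  where open ≡-Reasoning

sumF-updateAt-< : ∀ {n} (f : Fin n → ℕ) t h → h (f t) < f t → sumF (updateAt f t h) < sumF f
sumF-updateAt-< f t h lt = +-cancelʳ-< (f t) _ _ (begin-strict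
  sumF (updateAt f t h) + f t ≡⟨ sumF-updateAt f t h ⟩
  sumF f + h (f t)            <⟨ +-monoʳ-< (sumF f) lt ⟩
  sumF f + f t                ∎)
  where open ≤-Reasoning

sumF-updateAt-≤suc : ∀ {n} (f : Fin n → ℕ) t h → h (f t) ≤ suc (f t) →
                     sumF (updateAt f t h) ≤ suc (sumF f)
sumF-updateAt-≤suc f t h le = +-cancelʳ-≤ (f t) _ _ (begin
  sumF (updateAt f t h) + f t ≡⟨ sumF-updateAt f t h ⟩
  sumF f + h (f t)            ≤⟨ +-monoʳ-≤ (sumF f) le ⟩
  sumF f + suc (f t)          ≡⟨ +-suc (sumF f) (f t) ⟩
  suc (sumF f) + f t          ∎)
  where open ≤-Reasoning

updateAt-zero-≤ : ∀ {n} (f : Fin n → ℕ) t v → updateAt f t (const 0) v ≤ f v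
updateAt-zero-≤ f t v with v ≟ t
... | yes refl = ≤-trans (≤-reflexive (updateAt-updates v f)) z≤n
... | no v≢t   = ≤-reflexive (updateAt-minimal v t f v≢t)

indicator-∨-∧ : ∀ a b → ⟦ a ∨ b ⟧ + ⟦ a ∧ b ⟧ ≡ ⟦ a ⟧ + ⟦ b ⟧
indicator-∨-∧ false false = refl
indicator-∨-∧ false true  = refl
indicator-∨-∧ true  false = refl
indicator-∨-∧ true  true  = refl

indicator-split : ∀ a b → ⟦ a ∧ b ⟧ + ⟦ a ∧ not b ⟧ ≡ ⟦ a ⟧
indicator-split false b     = refl
indicator-split true  false = refl
indicator-split true  true  = refl

module _ {n : ℕ} where

  count-cong : {p q : Fin n → Bool} → (∀ i → p i ≡ q i) → count p ≡ count q
  count-cong p≗q = sumF-cong (cong ⟦_⟧ ∘ p≗q)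

  count-mono : {p q : Fin n → Bool} → (∀ i → p i ≡ true → q i ≡ true) → count p ≤ count q
  count-mono {p} {q} p⇒q = sumF-mono λ i → indicator-mono (p i) (q i) (p⇒q i)
    where
    indicator-mono : ∀ a b → (a ≡ true → b ≡ true) → ⟦ a ⟧ ≤ ⟦ b ⟧
    indicator-mono false _ _ = z≤n
    indicator-mono true  b a⇒b rewrite a⇒b refl = ≤-refl

  count-false : {p : Fin n → Bool} → (∀ i → p i ≡ false) → count p ≡ 0
  count-false p≗false = trans (count-cong p≗false) (sumF-zero n)

  count-∪-∩ : (p q : Fin n → Bool) →
              count (λ i → p i ∨ q i) + count (λ i → p i ∧ q i) ≡ count p + count q
  count-∪-∩ p q = sumF-+-pointwise λ i → indicator-∨-∧ (p i) (q i)

  count-split : (p q : Fin n → Bool) →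
                count (λ i → p i ∧ q i) + count (λ i → p i ∧ not (q i)) ≡ count p
  count-split p q = trans (sym (sumF-+ (λ i → ⟦ p i ∧ q i ⟧) (λ i → ⟦ p i ∧ not (q i) ⟧)))
                          (sumF-cong λ i → indicator-split (p i) (q i))

  count-at : (t : Fin n) (p : Fin n → Bool) → count (λ i → does (i ≟ t) ∧ p i) ≡ ⟦ p t ⟧
  count-at t p = trans (sumF-cong λ i → if-∧ (does (i ≟ t))) (sumF-at t (⟦_⟧ ∘ p))

  count-guarded : ∀ b (p : Fin n → Bool) → count (λ i → b ∧ p i) ≡ (if b then count p else 0)
  count-guarded true  p = refl
  count-guarded false p = sumF-zero n

module _ {n : ℕ} where

  infixr 6 _∩_ _∖_
  infixr 5 _∪_

  _∪_ _∩_ _∖_ : ArcSet n → ArcSet n → ArcSet n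
  (S ∪ T) u v = S u v ∨ T u v
  (S ∩ T) u v = S u v ∧ T u v
  (S ∖ T) u v = S u v ∧ not (T u v)

  _⊆_ : ArcSet n → ArcSet n → Set
  S ⊆ T = ∀ u v → S u v ≡ true → T u v ≡ true

  ∪-⊆ˡ : ∀ S T → S ⊆ (S ∪ T)
  ∪-⊆ˡ S T u v e rewrite e = refl

  ∪-⊆ʳ : ∀ S T → T ⊆ (S ∪ T)
  ∪-⊆ʳ S T u v e rewrite e = ∨-zeroʳ (S u v)

  ∩-intro : ∀ S T u v → S u v ≡ true → T u v ≡ true → (S ∩ T) u v ≡ true
  ∩-intro S T u v eS eT rewrite eS | eT = refl

  size-cong : ∀ {S T : ArcSet n} → Pointwise (Pointwise _≡_) S T → size S ≡ size T
  size-cong S≈T = sumF-cong λ u → count-cong (S≈T u)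

  size-∪-∩ : ∀ S T → size (S ∪ T) + size (S ∩ T) ≡ size S + size T
  size-∪-∩ S T = sumF-+-pointwise λ u → count-∪-∩ (S u) (T u)

  size-∪ : ∀ S T → size (S ∪ T) ≤ size S + size T
  size-∪ S T = ≤-trans (m≤m+n (size (S ∪ T)) (size (S ∩ T))) (≤-reflexive (size-∪-∩ S T))

  size-∩-∖ : ∀ S T → size (S ∩ T) + size (S ∖ T) ≡ size S
  size-∩-∖ S T = trans (sym (sumF-+ (λ u → count ((S ∩ T) u)) (λ u → count ((S ∖ T) u))))
                       (sumF-cong λ u → count-split (S u) (T u))

  member⇒1≤size : ∀ (S : ArcSet n) u v → S u v ≡ true → 1 ≤ size S
  member⇒1≤size S u v e =
    ≤-trans (≤-reflexive (cong ⟦_⟧ (sym e)))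
            (≤-trans (≤-sumF (λ w → ⟦ S u w ⟧) v) (≤-sumF (λ w → count (S w)) u))

  ⊆A-∪ : ∀ {D : Digraph n} {S T : ArcSet n} → S ⊆A D → T ⊆A D → (S ∪ T) ⊆A D
  ⊆A-∪ {S = S} S⊆D T⊆D u v e with S u v in eS
  ... | true  = S⊆D u v eS
  ... | false = T⊆D u v e

  ⊆A-∖ : ∀ {D : Digraph n} {S T : ArcSet n} → S ⊆A D → (S ∖ T) ⊆A D
  ⊆A-∖ S⊆D u v e = S⊆D u v (∧-conicalˡ _ _ e)

  ∖-false : ∀ {S T : ArcSet n} {u v} → (S ∖ T) u v ≡ false → S u v ≡ true → T u v ≡ true
  ∖-false e s rewrite s = not-injective e

  removeArcs-⊆ : ∀ {D : Digraph n} {S : ArcSet n} {u v} → arc (removeArcs D S) u v ≡ true →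
                 arc D u v ≡ true × S u v ≡ false
  removeArcs-⊆ e = ∧-conicalˡ _ _ e , not-injective (∧-conicalʳ _ _ e)

  removeArcs-removes : ∀ {D : Digraph n} {S : ArcSet n} {u v} → (arc D u v ≡ true → S u v ≡ true) →
                       arc (removeArcs D S) u v ≡ false
  removeArcs-removes {D} {S} {u} {v} removed with arc D u v
  ... | false = refl
  ... | true rewrite removed refl = refl

  removeArcs-cong : ∀ {D : Digraph n} {S T : ArcSet n} → Pointwise (Pointwise _≡_) S T → ∀ u v →
                    arc (removeArcs D S) u v ≡ arc (removeArcs D T) u v
  removeArcs-cong {D} S≈T u v = cong (λ b → arc D u v ∧ not b) (S≈T u v)

module _ {n : ℕ} (D : Digraph n) where

  In Out Incident : Fin n → ArcSet n
  In  t u v = does (v ≟ t) ∧ arc D u v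
  Out t u v = does (u ≟ t) ∧ arc D u v
  Incident t = In t ∪ Out t

  In-self : ∀ {t u} → arc D u t ≡ true → In t u t ≡ true
  In-self {t} e rewrite dec-true (t ≟ t) refl = e

  Out-self : ∀ {t v} → arc D t v ≡ true → Out t t v ≡ true
  Out-self {t} e rewrite dec-true (t ≟ t) refl = e

  In-⊆A : ∀ t → In t ⊆A D
  In-⊆A t u v e = ∧-conicalʳ _ _ e

  Incident-⊆A : ∀ t → Incident t ⊆A D
  Incident-⊆A t = ⊆A-∪ {D = D} {S = In t} (In-⊆A t) (λ u v e → ∧-conicalʳ (does (u ≟ t)) _ e)

  size-In : ∀ t → size (In t) ≡ indeg D t
  size-In t = sumF-cong λ u → count-at t (arc D u)

  size-In-∩ : ∀ t T → size (In t ∩ T) ≡ count (λ u → arc D u t ∧ T u t)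
  size-In-∩ t T = sumF-cong λ u →
    trans (count-cong λ v → ∧-assoc (does (v ≟ t)) (arc D u v) (T u v))
          (count-at t (λ v → arc D u v ∧ T u v))

  size-Out : ∀ t → size (Out t) ≡ outdeg D t
  size-Out t = trans (sumF-cong λ u → count-guarded (does (u ≟ t)) (arc D u))
                     (sumF-at t (count ∘ arc D))

  size-Incident : ∀ t → size (Incident t) ≤ degG D t
  size-Incident t =
    ≤-trans (size-∪ (In t) (Out t)) (≤-reflexive (cong₂ _+_ (size-In t) (size-Out t)))

arc⇒≢ : ∀ {n} (D : Digraph n) {u v} → arc D u v ≡ true → u ≢ v
arc⇒≢ D {u} a refl with trans (sym a) (loopless D u)
... | ()

Isolated : ∀ {n} → Digraph n → Fin n → Set
Isolated D t = ∀ w → arc D w t ≡ false × arc D t w ≡ false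

removing-Incident-isolates : ∀ {n} (D : Digraph n) {S : ArcSet n} {t} → Incident D t ⊆ S →
                             Isolated (removeArcs D S) t
removing-Incident-isolates D {S} {t} sub w =
  removeArcs-removes {D = D} {S} (λ e → sub w t (∪-⊆ˡ (In D t) (Out D t) w t (In-self D e))) ,
  removeArcs-removes {D = D} {S} (λ e → sub t w (∪-⊆ʳ (In D t) (Out D t) t w (Out-self D e)))

-- Italian domination

module _ {n : ℕ} where

  Dominated : Digraph n → (Fin n → ℕ) → Fin n → Set
  Dominated D f v = (2 ≤ count (λ w → arc D w v ∧ (f w ≡ᵇ 1)))
                  ⊎ (∃ λ w → (arc D w v ≡ true) × (f w ≡ 2))

  dominated? : ∀ D f v → Dec (Dominated D f v)
  dominated? D f v = (2 ℕ.≤? _) ⊎-dec any? λ w → (arc D w v Bool.≟ true) ×-dec (f w ℕ.≟ 2)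

  isIDF? : ∀ D f → Dec (IsIDF D f)
  isIDF? D f = all? (λ v → f v ℕ.≤? 2) ×-dec all? λ v → (f v ℕ.≟ 0) →-dec dominated? D f v

  SameArcs : Digraph n → Digraph n → Set
  SameArcs D D′ = ∀ u v → arc D u v ≡ arc D′ u v

  Dominated-resp : ∀ {D D′ : Digraph n} {f f′ v} → SameArcs D D′ → (∀ w → f w ≡ f′ w) →
                   Dominated D f v → Dominated D′ f′ v
  Dominated-resp {v = v} same f≗f′ (inj₁ two) =
    inj₁ (subst (2 ≤_) (count-cong λ w → cong₂ _∧_ (same w v) (cong (_≡ᵇ 1) (f≗f′ w))) two)
  Dominated-resp {v = v} same f≗f′ (inj₂ (w , a , e)) =
    inj₂ (w , trans (sym (same w v)) a , trans (sym (f≗f′ w)) e)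

  IsIDF-resp : ∀ {D D′ : Digraph n} {f f′} → SameArcs D D′ → (∀ w → f w ≡ f′ w) →
               IsIDF D f → IsIDF D′ f′
  IsIDF-resp {D} {D′} same f≗f′ (bounded , dominating) =
    (λ v → subst (_≤ 2) (f≗f′ v) (bounded v)) ,
    (λ v e → Dominated-resp {D} {D′} same f≗f′ (dominating v (trans (f≗f′ v) e)))

  Dominated-transfer : ∀ {D D′ : Digraph n} {f f′} v t →
                       (∀ {w} → arc D′ w v ≡ true → arc D w t ≡ true × f w ≡ f′ w) →
                       Dominated D′ f′ v → Dominated D f t
  Dominated-transfer {D} {D′} {f} {f′} v t inherit (inj₁ two) =
    inj₁ (≤-trans two (count-mono λ w e → step {w} (∧-conicalˡ _ _ e) (∧-conicalʳ _ _ e)))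
    where
    step : ∀ {w} → arc D′ w v ≡ true → (f′ w ≡ᵇ 1) ≡ true → (arc D w t ∧ (f w ≡ᵇ 1)) ≡ true
    step a one with inherit a
    ... | a′ , e rewrite a′ | e = one
  Dominated-transfer v t inherit (inj₂ (w , a , two)) with inherit a
  ... | a′ , e = inj₂ (w , a′ , trans e two)

  IDF-positive-without-in-arcs : ∀ {D : Digraph n} {f v} → (∀ w → arc D w v ≡ false) →
                                 IsIDF D f → 0 < f v
  IDF-positive-without-in-arcs {D} {f} {v} no-in (_ , dominating) =
    n≢0⇒n>0 λ fv≡0 → undominated (dominating v fv≡0)
    where
    undominated : ¬ Dominated D f v
    undominated (inj₁ two) =
      contradiction (≤-trans two (≤-reflexive (count-false λ w → cong (_∧ (f w ≡ᵇ 1)) (no-in w))))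
                    λ ()
    undominated (inj₂ (w , a , _)) with trans (sym a) (no-in w)
    ... | ()

  hasIDFOfWeight? : ∀ D k → Dec (∃ λ f → IsIDF D f × weight f ≡ k)
  hasIDFOfWeight? D k =
    map′ (λ (g , p) → toℕ ∘ g , p) encode
         (exhaustible-Vector refl exhaustible-Fin n resp
                             λ g → isIDF? D (toℕ ∘ g) ×-dec (weight (toℕ ∘ g) ℕ.≟ k))
    where
    IsIDFOfWeight : Vector (Fin 3) n → Set
    IsIDFOfWeight g = IsIDF D (toℕ ∘ g) × weight (toℕ ∘ g) ≡ k
    resp : IsIDFOfWeight Respects Pointwise _≡_
    resp g≈h (idf , w) =
      IsIDF-resp {D} {D} (λ _ _ → refl) (cong toℕ ∘ g≈h) idf ,
      trans (sym (sumF-cong (cong toℕ ∘ g≈h))) w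
    encode : ∃ (λ f → IsIDF D f × weight f ≡ k) → ∃ IsIDFOfWeight
    encode (f , idf , w) =
      g , IsIDF-resp {D} {D} (λ _ _ → refl) (sym ∘ decode) idf , trans (sumF-cong decode) w
      where
      g : Vector (Fin 3) n
      g v = fromℕ< (s≤s (proj₁ idf v))
      decode : ∀ v → toℕ (g v) ≡ f v
      decode v = toℕ-fromℕ< _

  gammaI-exists : ∀ D → ∃ (IsGammaI D)
  gammaI-exists D
    with g , hasIDF , minimal ← least-witness (hasIDFOfWeight? D) {weight {n} (const 1)}
                                   (const 1 , ((λ _ → s≤s z≤n) , λ _ ()) , refl)
    = g , hasIDF , λ f idf → minimal (f , idf , refl)

  gammaI-unique : ∀ {D : Digraph n} {g g′} → IsGammaI D g → IsGammaI D g′ → g ≡ g′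
  gammaI-unique {g = g} {g′} ((f , idf , w) , minimal) ((f′ , idf′ , w′) , minimal′) =
    ≤-antisym (subst (g ≤_) w′ (minimal f′ idf′)) (subst (g′ ≤_) w (minimal′ f idf))

  IsGammaI-resp : ∀ {D D′ : Digraph n} {g} → SameArcs D D′ → IsGammaI D g → IsGammaI D′ g
  IsGammaI-resp {D} {D′} same ((f , idf , w) , minimal) =
    (f , IsIDF-resp {D} {D′} same (λ _ → refl) idf , w) ,
    λ f′ idf′ → minimal f′ (IsIDF-resp {D′} {D} (λ u v → sym (same u v)) (λ _ → refl) idf′)

module _ {n : ℕ} (D : Digraph n) where

  increases? : ∀ S → Dec (Increases D S)
  increases? S
    with g , γ ← gammaI-exists D | g′ , γ′ ← gammaI-exists (removeArcs D S)
    = map′ (λ g<g′ h h′ δ δ′ →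
              subst₂ _<_ (gammaI-unique {D = D} γ δ)
                         (gammaI-unique {D = removeArcs D S} γ′ δ′) g<g′)
           (λ increases → increases g g′ γ γ′)
           (g ℕ.<? g′)

  BondageSetOfSize : ℕ → Set
  BondageSetOfSize k = ∃ λ S → S ⊆A D × Increases D S × size S ≡ k

  hasBondageSetOfSize? : ∀ k → Dec (BondageSetOfSize k)
  hasBondageSetOfSize? k =
    exhaustible-Vector (λ _ → refl) (exhaustible-Vector refl exhaustible-Bool n) n resp
      λ S → ⊆A? S ×-dec increases? S ×-dec (size S ℕ.≟ k)
    where
    ⊆A? : ∀ S → Dec (S ⊆A D)
    ⊆A? S = all? λ u → all? λ v → (S u v Bool.≟ true) →-dec (arc D u v Bool.≟ true)
    resp : (λ S → S ⊆A D × Increases D S × size S ≡ k) Respects Pointwise (Pointwise _≡_)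
    resp {S} {T} S≈T (S⊆D , increases , s) =
      (λ u v e → S⊆D u v (trans (S≈T u v) e)) ,
      (λ g g′ γ γ′ → increases g g′ γ
         (IsGammaI-resp {D = removeArcs D T} {removeArcs D S}
            (removeArcs-cong {D = D} λ u v → sym (S≈T u v)) γ′)) ,
      trans (sym (size-cong S≈T)) s

  bondage-exists : ∀ S → S ⊆A D → Increases D S → ∃ λ b → IsItalianBondage D b × b ≤ size S
  bondage-exists S S⊆D increases =
    bondage (least-witness hasBondageSetOfSize? (S , S⊆D , increases , refl))
    where
    bondage : (∃ λ b → BondageSetOfSize b × (∀ {k} → BondageSetOfSize k → b ≤ k)) →
              ∃ λ b → IsItalianBondage D b × b ≤ size S
    bondage (b , hasSet , minimal) =
      b , (hasSet , λ S′ S′⊆D increases′ → minimal (S′ , S′⊆D , increases′ , refl)) ,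
      minimal (S , S⊆D , increases , refl)

-- Collapsing an Italian dominating function

promote : ℕ → ℕ
promote ℕ.zero  = 0
promote (suc _) = 2

promote-cases : ∀ k → k ≡ 0 ⊎ promote k ≡ 2
promote-cases ℕ.zero  = inj₁ refl
promote-cases (suc _) = inj₂ refl

promote-≤2 : ∀ k → promote k ≤ 2
promote-≤2 ℕ.zero  = z≤n
promote-≤2 (suc _) = ≤-refl

promote-≤suc : ∀ k → promote k ≤ suc k
promote-≤suc ℕ.zero  = z≤n
promote-≤suc (suc _) = s≤s (s≤s z≤n)

module Collapse {n} {D D′ : Digraph n} {x y z : Fin n}
  (x≢z : x ≢ z) (yx : arc D y x ≡ true) (yz : arc D y z ≡ true)
  (D′⊆D : ∀ {u v} → arc D′ u v ≡ true → arc D u v ≡ true)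
  (x-isolated : Isolated D′ x) (z-isolated : Isolated D′ z)
  (into-y : ∀ {w} → arc D′ w y ≡ true → arc D w x ≡ true × arc D w z ≡ true)
  where

  x≢y : x ≢ y
  x≢y = ≢-sym (arc⇒≢ D yx)

  z≢y : z ≢ y
  z≢y = ≢-sym (arc⇒≢ D yz)

  source≢ : ∀ {t w v} → Isolated D′ t → arc D′ w v ≡ true → w ≢ t
  source≢ {v = v} isolated a refl with trans (sym a) (proj₂ (isolated v))
  ... | ()

  module _ (f′ : Fin n → ℕ) (idf′ : IsIDF D′ f′) where

    f₁ f₂ f : Fin n → ℕ
    f₁ = updateAt f′ x (const 0)
    f₂ = updateAt f₁ z (const 0)
    f  = updateAt f₂ y promote

    f-at-y : f y ≡ promote (f′ y)
    f-at-y = trans (updateAt-updates y f₂)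
                   (cong promote (trans (updateAt-minimal y z f₁ (≢-sym z≢y))
                                        (updateAt-minimal y x f′ (≢-sym x≢y))))

    f-elsewhere : ∀ {v} → v ≢ x → v ≢ z → v ≢ y → f v ≡ f′ v
    f-elsewhere {v} v≢x v≢z v≢y =
      trans (updateAt-minimal v y f₂ v≢y)
            (trans (updateAt-minimal v z f₁ v≢z) (updateAt-minimal v x f′ v≢x))

    f-bounded : ∀ v → f v ≤ 2
    f-bounded v with v ≟ y
    ... | yes refl = subst (_≤ 2) (sym f-at-y) (promote-≤2 (f′ y))
    ... | no v≢y   = begin
      f v   ≡⟨ updateAt-minimal v y f₂ v≢y ⟩
      f₂ v  ≤⟨ updateAt-zero-≤ f₁ z v ⟩
      f₁ v  ≤⟨ updateAt-zero-≤ f′ x v ⟩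
      f′ v  ≤⟨ proj₁ idf′ v ⟩
      2     ∎
      where open ≤-Reasoning

    transfer : ∀ v t → (∀ {w} → arc D′ w v ≡ true → arc D w t ≡ true × f w ≡ f′ w) →
               Dominated D′ f′ v → Dominated D f t
    transfer = Dominated-transfer {D = D} {D′} {f} {f′}

    positive : ∀ {t} → Isolated D′ t → 0 < f′ t
    positive {t} isolated = IDF-positive-without-in-arcs {D = D′} {f′} {t} (proj₁ ∘ isolated) idf′

    lighter : weight f < weight f′
    lighter = begin-strict
      sumF f        ≤⟨ sumF-updateAt-≤suc f₂ y promote (promote-≤suc (f₂ y)) ⟩
      suc (sumF f₂) ≤⟨ sumF-updateAt-< f₁ z (const 0) f₁-positive-at-z ⟩
      sumF f₁       <⟨ sumF-updateAt-< f′ x (const 0) (positive x-isolated) ⟩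
      sumF f′       ∎
      where
      open ≤-Reasoning
      f₁-positive-at-z : 0 < f₁ z
      f₁-positive-at-z =
        subst (0 <_) (sym (updateAt-minimal z x f′ (≢-sym x≢z))) (positive z-isolated)

    module _ (f′y≡0 : f′ y ≡ 0) where

      agrees-off-xz : ∀ {v} → v ≢ x → v ≢ z → f v ≡ f′ v
      agrees-off-xz {v} v≢x v≢z with v ≟ y
      ... | yes refl = trans f-at-y (trans (cong promote f′y≡0) (sym f′y≡0))
      ... | no v≢y   = f-elsewhere v≢x v≢z v≢y

      agrees-at-sources : ∀ {w v} → arc D′ w v ≡ true → f w ≡ f′ w
      agrees-at-sources a = agrees-off-xz (source≢ x-isolated a) (source≢ z-isolated a)

      dominated-unpromoted : ∀ v → f v ≡ 0 → Dominated D f v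
      dominated-unpromoted v fv≡0 with v ≟ x | v ≟ z
      ... | yes refl | _ =
        transfer y x (λ a → proj₁ (into-y a) , agrees-at-sources a) (proj₂ idf′ y f′y≡0)
      ... | no _ | yes refl =
        transfer y z (λ a → proj₂ (into-y a) , agrees-at-sources a) (proj₂ idf′ y f′y≡0)
      ... | no v≢x | no v≢z =
        transfer v v (λ a → D′⊆D a , agrees-at-sources a)
                     (proj₂ idf′ v (trans (sym (agrees-off-xz v≢x v≢z)) fv≡0))

    dominated-promoted : f y ≡ 2 → ∀ v → f v ≡ 0 → Dominated D f v
    dominated-promoted fy≡2 v fv≡0 with v ≟ x | v ≟ z | v ≟ y
    ... | yes refl | _        | _ = inj₂ (y , yx , fy≡2)
    ... | no _     | yes refl | _ = inj₂ (y , yz , fy≡2)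
    ... | no _     | no _     | yes refl with trans (sym fv≡0) fy≡2
    ...   | ()
    dominated-promoted fy≡2 v fv≡0 | no v≢x | no v≢z | no v≢y with arc D′ y v in yv
    ...   | true  = inj₂ (y , D′⊆D yv , fy≡2)
    ...   | false =
      transfer v v (λ a → D′⊆D a , inherits a)
                   (proj₂ idf′ v (trans (sym (f-elsewhere v≢x v≢z v≢y)) fv≡0))
      where
      inherits : ∀ {w} → arc D′ w v ≡ true → f w ≡ f′ w
      inherits a = f-elsewhere (source≢ x-isolated a) (source≢ z-isolated a)
                               λ { refl → contradiction (trans (sym a) yv) λ () }

    collapsed-IDF : IsIDF D f
    collapsed-IDF = f-bounded , dominated
      where
      dominated : ∀ v → f v ≡ 0 → Dominated D f v
      dominated with promote-cases (f′ y)
      ... | inj₁ f′y≡0  = dominated-unpromoted f′y≡0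
      ... | inj₂ promoted = dominated-promoted (trans f-at-y promoted)

  gammaI-< : ∀ {g g′} → IsGammaI D g → IsGammaI D′ g′ → g < g′
  gammaI-< {g} (_ , minimal) ((f′ , idf′ , w′) , _) =
    subst (g <_) w′ (≤-<-trans (minimal _ (collapsed-IDF f′ idf′)) (lighter f′ idf′))

-- The arcs removed around the path x ← y → z

module _ {n : ℕ} (D : Digraph n) (x y z : Fin n) where

  CommonSource : ArcSet n
  CommonSource u _ = arc D u x ∧ arc D u z

  private
    X Z Y : ArcSet n
    X = Incident D x
    Z = Incident D z
    Y = In D y ∖ CommonSource

  removedArcs : ArcSet n
  removedArcs = (X ∪ Z) ∪ Y

  removedArcs-⊆A : removedArcs ⊆A D
  removedArcs-⊆A = ⊆A-∪ {D = D} (⊆A-∪ {D = D} (Incident-⊆A D x) (Incident-⊆A D z))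
                            (⊆A-∖ {D = D} (In-⊆A D y))

  size-commonSource : size (In D y ∩ CommonSource) ≡ commonIn D x y z
  size-commonSource = trans (size-In-∩ D y CommonSource)
                            (count-cong λ u → ∧-left-comm (arc D u y) (arc D u x) (arc D u z))

  size-removedArcs : size removedArcs + size (Incident D x ∩ Incident D z) + commonIn D x y z
                 ≤ degG D x + indeg D y + degG D z
  size-removedArcs = begin
    size removedArcs + size (X ∩ Z) + c
      ≤⟨ +-monoˡ-≤ c (+-monoˡ-≤ (size (X ∩ Z)) (size-∪ (X ∪ Z) Y)) ⟩
    size (X ∪ Z) + size Y + size (X ∩ Z) + c
      ≡⟨ +-assoc (size (X ∪ Z) + size Y) (size (X ∩ Z)) c ⟩
    (size (X ∪ Z) + size Y) + (size (X ∩ Z) + c)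
      ≡⟨ interchange (size (X ∪ Z)) (size Y) (size (X ∩ Z)) c ⟩
    (size (X ∪ Z) + size (X ∩ Z)) + (size Y + c)
      ≡⟨ cong₂ _+_ (size-∪-∩ X Z) y-split ⟩
    (size X + size Z) + indeg D y
      ≤⟨ +-monoˡ-≤ (indeg D y) (+-mono-≤ (size-Incident D x) (size-Incident D z)) ⟩
    (degG D x + degG D z) + indeg D y
      ≡⟨ xy∙z≈xz∙y (degG D x) (degG D z) (indeg D y) ⟩
    degG D x + indeg D y + degG D z ∎
    where
    open ≤-Reasoning
    c : ℕ
    c = commonIn D x y z
    y-split : size Y + c ≡ indeg D y
    y-split = trans (+-comm (size Y) c)
                    (trans (cong (_+ size Y) (sym size-commonSource))
                           (trans (size-∩-∖ (In D y) CommonSource) (size-In D y)))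

  adjacent⇒1≤size-∩ : adjG D x z ≡ true → 1 ≤ size (Incident D x ∩ Incident D z)
  adjacent⇒1≤size-∩ adj with arc D x z in xz
  ... | true  = member⇒1≤size (X ∩ Z) x z
                  (∩-intro X Z x z (∪-⊆ʳ (In D x) (Out D x) x z (Out-self D xz))
                               (∪-⊆ˡ (In D z) (Out D z) x z (In-self D xz)))
  ... | false = member⇒1≤size (X ∩ Z) z x
                  (∩-intro X Z z x (∪-⊆ˡ (In D x) (Out D x) z x (In-self D adj))
                               (∪-⊆ʳ (In D z) (Out D z) z x (Out-self D adj)))

  removedArcs-increases : x ≢ z → arc D y x ≡ true → arc D y z ≡ true → Increases D removedArcs
  removedArcs-increases x≢z yx yz _ _ =
    Collapse.gammaI-< {D = D} {removeArcs D removedArcs} {x} {y} {z} x≢z yx yz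
    (λ a → proj₁ (removeArcs-⊆ {D = D} {removedArcs} a))
    (removing-Incident-isolates D {removedArcs} λ u v e → ∪-⊆ˡ (X ∪ Z) Y u v (∪-⊆ˡ X Z u v e))
    (removing-Incident-isolates D {removedArcs} λ u v e → ∪-⊆ˡ (X ∪ Z) Y u v (∪-⊆ʳ X Z u v e))
    into-y
    where
    into-y : ∀ {w} → arc (removeArcs D removedArcs) w y ≡ true → arc D w x ≡ true × arc D w z ≡ true
    into-y {w} a with removeArcs-⊆ {D = D} {removedArcs} a
    ... | a′ , kept = ∧-conicalˡ _ _ common , ∧-conicalʳ _ _ common
      where
      common : CommonSource w y ≡ true
      common = ∖-false {S = In D y} {CommonSource} (∨-conicalʳ _ _ kept) (In-self D a′)

bondage-bounds : ∀ {b s e c t} → b ≤ s → s + e + c ≤ t → (b ≤ t ∸ c) × (1 ≤ e → b ≤ t ∸ 1 ∸ c)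
bondage-bounds {b} {s} {e} {c} {t} b≤s s+e+c≤t =
  m+n≤o⇒m≤o∸n b (≤-trans (+-monoˡ-≤ c (m≤m+n b e)) b+e+c≤t) ,
  λ 1≤e → subst (b ≤_) (sym (∸-+-assoc t 1 c))
                (m+n≤o⇒m≤o∸n b (≤-trans (≤-reflexive (sym (+-assoc b 1 c)))
                                        (≤-trans (+-monoˡ-≤ c (+-monoʳ-≤ b 1≤e)) b+e+c≤t)))
  where
  b+e+c≤t : b + e + c ≤ t
  b+e+c≤t = ≤-trans (+-monoˡ-≤ c (+-monoˡ-≤ e b≤s)) s+e+c≤t

theorem3p1 : ∀ {n} (D : Digraph n) (x y z : Fin n) →
    x ≢ z → arc D y x ≡ true → arc D y z ≡ true →
    (∃ λ b → IsItalianBondage D b ×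
      (b ≤ degG D x + indeg D y + degG D z ∸ commonIn D x y z))
    × (adjG D x z ≡ true →
      ∃ λ b → IsItalianBondage D b ×
        (b ≤ degG D x + indeg D y + degG D z ∸ 1 ∸ commonIn D x y z))
theorem3p1 D x y z x≢z yx yz =
  let b , bondage , b≤size = bondage-exists D (removedArcs D x y z) (removedArcs-⊆A D x y z)
                                               (removedArcs-increases D x y z x≢z yx yz)
      ≤-general , ≤-adjacent = bondage-bounds b≤size (size-removedArcs D x y z)
  in (b , bondage , ≤-general) , λ adj → b , bondage , ≤-adjacent (adjacent⇒1≤size-∩ D x y z adj)
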